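{- The fragment $\mathcal{N}^2$ has the finite model property: every finite set of $\mathcal{N}^2$-formulas that has a model has a finite model.
   Context: We work in first-order logic extended with counting quantifiers $\exists_{\leq C}$, $\exists_{\geq C}$ ($C \geq 0$) with the obvious semantics. $\mathcal{N}^2$ consists of all formulas of the forms $\exists_{\bowtie C} x (p(x) \wedge q(x))$ and $\exists_{\bowtie C} x (p(x) \wedge \neg q(x))$, together with all formulas of the form $\exists_{\bowtie C} x (p(x) \wedge \exists_{\bowtie' D} y (q(y) \wedge r(x,y)))$, where $\bowtie, \bowtie' \in \{\leq, \geq\}$, $C, D \geq 0$ are integers, $p, q$ are unary predicates and $r$ is a binary predicate. -}

module Defs where

open import Level using (Level; _⊔_; suc)
open import Data.Nat using (ℕ)
open import Data.Fin using (Fin)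
open import Data.Product using (Σ; _×_)
open import Data.List using (List)
open import Data.List.Relation.Unary.All using (All)
open import Relation.Binary.PropositionalEquality using (_≡_)
open import Relation.Nullary using (¬_)
open import Function.Definitions using (Injective)

data Cmp : Set where
  le ge : Cmp

UPred : Set
UPred = ℕ

BPred : Set
BPred = ℕ

-- Syntax of the fragment N²:
--   pos ⋈ C p q            ~  ∃_{⋈C} x (p(x) ∧ q(x))
--   neg ⋈ C p q            ~  ∃_{⋈C} x (p(x) ∧ ¬ q(x))
--   nest ⋈ C p ⋈' D q r    ~  ∃_{⋈C} x (p(x) ∧ ∃_{⋈'D} y (q(y) ∧ r(x,y)))
data N2 : Set where
  pos  : Cmp → ℕ → UPred → UPred → N2
  neg  : Cmp → ℕ → UPred → UPred → N2
  nest : Cmp → ℕ → UPred → Cmp → ℕ → UPred → BPred → N2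

record Interp {a : Level} (D : Set a) (ℓ : Level) : Set (a ⊔ Level.suc ℓ) where
  field
    unary  : UPred → D → Set ℓ
    binary : BPred → D → D → Set ℓ

open Interp public

AtLeast : {a ℓ : Level} {D : Set a} → ℕ → (D → Set ℓ) → Set (a ⊔ ℓ)
AtLeast {D = D} C P =
  Σ (Fin C → D) (λ f → Injective _≡_ _≡_ f × ((i : Fin C) → P (f i)))

AtMost : {a ℓ : Level} {D : Set a} → ℕ → (D → Set ℓ) → Set (a ⊔ ℓ)
AtMost C P = ¬ AtLeast (Data.Nat.suc C) P

Count : {a ℓ : Level} {D : Set a} → Cmp → ℕ → (D → Set ℓ) → Set (a ⊔ ℓ)
Count le C P = AtMost C P
Count ge C P = AtLeast C P

_⊨_ : {a ℓ : Level} {D : Set a} → Interp D ℓ → N2 → Set (a ⊔ ℓ)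
M ⊨ pos c C p q = Count c C (λ x → unary M p x × unary M q x)
M ⊨ neg c C p q = Count c C (λ x → unary M p x × ¬ unary M q x)
M ⊨ nest c C p c' D q r =
  Count c C (λ x → unary M p x × Count c' D (λ y → unary M q y × binary M r x y))

_⊨all_ : {a ℓ : Level} {D : Set a} → Interp D ℓ → List N2 → Set (a ⊔ ℓ)
M ⊨all Φ = All (M ⊨_) Φ

-- Φ has a model: a nonempty domain D with an interpretation satisfying Φ.
HasModel : (a ℓ : Level) → List N2 → Set (Level.suc a ⊔ Level.suc ℓ)
HasModel a ℓ Φ = Σ (Set a) (λ D → D × Σ (Interp D ℓ) (λ M → M ⊨all Φ))

HasFiniteModel : List N2 → Set₁
HasFiniteModel Φ = Σ ℕ (λ n → Σ (Interp (Fin (Data.Nat.suc n)) Level.zero) (λ M → M ⊨all Φ))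

-- Small models are decidable: a model with at most a given number of elements can be presented
-- by Boolean tables and searched for exhaustively.  So it suffices to show that a small model
-- cannot fail to exist, and under ¬ ¬ classical reasoning is available.
--
-- Classically, let the unary predicates of Φ be among p₀ … pₙ₋₁, let K exceed every inner
-- threshold D of Φ, and let the type of an element be the set of pᵢ it satisfies.  Take a finite
-- set S of elements of the given model: the witnesses of the outer ∃≥ formulas and, for every
-- type, 2nK elements of that type, or all of them if there are fewer.  Unary predicates are
-- restricted to S.  For x ∈ S and binary r, choose for each q up to K elements y with
-- q(y) ∧ r(x, y); these at most nK elements embed injectively and type-preservingly into S, since
-- each type either lies inside S or has 2nK representatives there, and r(x, ·) is interpreted as
-- the image.  Then every x ∈ S has, for each q, as many q-elements among its r-successors as in
-- the given model, up to K, so the inner quantifiers agree on S; the outer ones transfer because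
-- S contains their witnesses.

module Submission where

open import Defs
open import Level using (Level; _⊔_; 0ℓ)
open import Data.Bool using (Bool; true; false; T; T?)
open import Data.Empty using (⊥-elim)
open import Data.Fin using (Fin; zero; suc; inject≤) renaming (_≟_ to _≟ᶠ_)
open import Data.Fin.Properties using (any?; inject≤-injective; injective⇒≤)
open import Data.List using (List; []; _∷_; _++_; length; lookup; tabulate; map; filter; allFin; upTo)
open import Data.List.Properties using (length-++; length-tabulate; length-upTo)
open import Data.List.Membership.Propositional using (_∈_; _∉_)
open import Data.List.Membership.Propositional.Properties
  using (∈-++⁺ˡ; ∈-++⁺ʳ; ∈-map⁺; ∈-tabulate⁺; ∈-lookup; ∈-filter⁺; ∈-allFin; ∈-upTo⁺)
open import Data.List.Relation.Binary.Subset.Propositional using (_⊆_)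
open import Data.List.Relation.Unary.All as All using (All; []; _∷_)
open import Data.List.Relation.Unary.All.Properties using (¬Any⇒All¬; all-filter; ++⁺; tabulate⁺)
open import Data.List.Relation.Unary.AllPairs using ([]; _∷_)
open import Data.List.Relation.Unary.Any using (here; there; index)
open import Data.List.Relation.Unary.Any.Properties using (lookup-index)
open import Data.List.Relation.Unary.Unique.Propositional using (Unique)
open import Data.List.Relation.Unary.Unique.Propositional.Properties using (filter⁺; allFin⁺)
open import Data.Nat using (ℕ; zero; suc; _+_; _*_; _≤_; _<_; z≤n; s≤s; z<s; s<s; _≤?_; anyUpTo?)
open import Data.Nat.ListAction using (sum)
open import Data.Nat.Properties
  using (≤-refl; ≤-trans; ≤-reflexive; n≤1+n; m≤n⇒m≤1+n; ≮⇒≥; <⇒≱; +-mono-≤; +-suc; m≤m+n; m≤n+m)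
open import Data.Product using (Σ; ∃; _×_; _,_; proj₁; proj₂)
open import Data.Product.Function.NonDependent.Propositional using (_×-⇔_)
open import Data.Sum using (_⊎_; inj₁; inj₂)
open import Data.Vec as Vec using (Vec; []; _∷_)
open import Data.Vec.Functional using () renaming (_∷_ to _∷ᶠ_)
open import Data.Vec.Properties using (lookup∘tabulate)
open import Function using (_∘_; id; const; _⇔_; mk⇔; Equivalence)
open import Function.Construct.Composition using (_⇔-∘_)
open import Function.Construct.Identity using (⇔-id)
open import Function.Construct.Symmetry using (⇔-sym)
open import Function.Definitions using (Injective)
open import Function.Related.TypeIsomorphisms using (¬-cong-⇔)
open import Relation.Binary.PropositionalEquality using (_≡_; _≢_; refl; sym; trans; cong; subst)
open import Relation.Nullary using (¬_; Dec; yes; no; ¬?; map′; _×-dec_; _⊎-dec_)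
open import Relation.Nullary.Decidable
  using (isYes; toWitness; fromWitness; decidable-stable; ¬¬-excluded-middle)
open import Relation.Nullary.Negation using (¬¬-map)
open import Relation.Unary using (Decidable)

open Equivalence using (to; from)

private variable
  a b ℓ ℓ′ : Level
  A : Set a
  B : Set b
  P Q : A → Set ℓ
  k n C : ℕ
  x y : A
  xs ys : List A

-- Classical reasoning under double negation

return : A → ¬ ¬ A
return x ¬x = ¬x x

_>>=_ : ¬ ¬ A → (A → ¬ ¬ B) → ¬ ¬ B
(¬¬x >>= f) ¬y = ¬¬x (λ x → f x ¬y)

¬¬-truth-value : (P : Set ℓ) → ¬ ¬ Σ Bool (λ b → T b ⇔ P)
¬¬-truth-value P = ¬¬-map (λ P? → isYes P? , mk⇔ toWitness fromWitness) ¬¬-excluded-middle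

¬¬-Π-Fin : {R : Fin n → Set ℓ} → (∀ i → ¬ ¬ R i) → ¬ ¬ (∀ i → R i)
¬¬-Π-Fin {n = zero}  _ = return λ ()
¬¬-Π-Fin {n = suc n} f = do
  r₀ ← f zero
  rs ← ¬¬-Π-Fin (f ∘ suc)
  return λ { zero → r₀ ; (suc i) → rs i }

¬¬-tabulate : {R : Fin n → B → Set ℓ} → (∀ i → ¬ ¬ Σ B (R i)) →
              ¬ ¬ Σ (Vec B n) λ v → ∀ i → R i (Vec.lookup v i)
¬¬-tabulate {R = R} f = ¬¬-map
  (λ g → Vec.tabulate (proj₁ ∘ g) , λ i → subst (R i) (sym (lookup∘tabulate _ i)) (proj₂ (g i)))
  (¬¬-Π-Fin f)

lookupOr : A → Vec A n → ℕ → A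
lookupOr d []       _       = d
lookupOr d (x ∷ _)  zero    = x
lookupOr d (_ ∷ xs) (suc p) = lookupOr d xs p

¬¬-vec : (d : B) {R : ℕ → B → Set ℓ} → (∀ {p} → p < n → ¬ ¬ Σ B (R p)) →
         ¬ ¬ Σ (Vec B n) λ v → ∀ {p} → p < n → R p (lookupOr d v p)
¬¬-vec {n = zero}  d f = return ([] , λ ())
¬¬-vec {n = suc n} d f = do
  (x , Rx) ← f z<s
  (v , Rv) ← ¬¬-vec d (f ∘ s<s)
  return (x ∷ v , λ { {zero} _ → Rx ; {suc p} (s<s p<n) → Rv p<n })

¬¬-All : (∀ x → ¬ ¬ P x) → ∀ xs → ¬ ¬ All P xs
¬¬-All f []       = return []
¬¬-All f (x ∷ xs) = do
  px  ← f x
  pxs ← ¬¬-All f xs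
  return (px ∷ pxs)

-- Lists

lookup-injective : Unique xs → Injective _≡_ _≡_ (lookup xs)
lookup-injective (_ ∷ _)  {zero}  {zero}  _  = refl
lookup-injective (x∉ ∷ _) {zero}  {suc j} eq = ⊥-elim (All.lookup x∉ (∈-lookup j) eq)
lookup-injective (x∉ ∷ _) {suc i} {zero}  eq = ⊥-elim (All.lookup x∉ (∈-lookup i) (sym eq))
lookup-injective (_ ∷ u)  {suc i} {suc j} eq = cong suc (lookup-injective u eq)

cons-injective : {f : Fin n → A} → Injective _≡_ _≡_ f → (∀ i → x ≢ f i) → Injective _≡_ _≡_ (x ∷ᶠ f)
cons-injective f-inj x∉f {zero}  {zero}  _  = refl
cons-injective f-inj x∉f {zero}  {suc j} eq = ⊥-elim (x∉f j eq)
cons-injective f-inj x∉f {suc i} {zero}  eq = ⊥-elim (x∉f i (sym eq))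
cons-injective f-inj x∉f {suc i} {suc j} eq = cong suc (f-inj eq)

injective⇒≤length : {f : Fin k → A} → Injective _≡_ _≡_ f → (∀ m → f m ∈ xs) → k ≤ length xs
injective⇒≤length {xs = xs} f-inj f∈xs = injective⇒≤ λ {i} {j} eq → f-inj
  (trans (lookup-index (f∈xs i)) (trans (cong (lookup xs) eq) (sym (lookup-index (f∈xs j)))))

injective⇒¬¬∃∉ : {f : Fin k → A} → Injective _≡_ _≡_ f → length xs < k → ¬ ¬ ∃ λ m → f m ∉ xs
injective⇒¬¬∃∉ f-inj |xs|<k ¬∃∉ =
  ¬¬-Π-Fin (λ m f∉xs → ¬∃∉ (m , f∉xs)) (λ f∈xs → <⇒≱ |xs|<k (injective⇒≤length f-inj f∈xs))

unique⊆⇒length≤ : Unique xs → xs ⊆ ys → length xs ≤ length ys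
unique⊆⇒length≤ xs-unique xs⊆ys = injective⇒≤length (lookup-injective xs-unique) (xs⊆ys ∘ ∈-lookup)

deduplicate : (xs : List A) → ¬ ¬ Σ (List A) λ ys → Unique ys × xs ⊆ ys × ys ⊆ xs
deduplicate []       = return ([] , [] , (λ ()) , (λ ()))
deduplicate (x ∷ xs) = do
  (ys , ys-unique , xs⊆ys , ys⊆xs) ← deduplicate xs
  ¬¬-map (insert ys ys-unique xs⊆ys ys⊆xs) ¬¬-excluded-middle
  where
  insert : (ys : List _) → Unique ys → xs ⊆ ys → ys ⊆ xs → Dec (x ∈ ys) →
           Σ (List _) λ zs → Unique zs × x ∷ xs ⊆ zs × zs ⊆ x ∷ xs
  insert ys ys-unique xs⊆ys ys⊆xs (yes x∈ys) =
    ys , ys-unique , (λ { (here refl) → x∈ys ; (there z∈xs) → xs⊆ys z∈xs }) , λ z∈ys → there (ys⊆xs z∈ys)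
  insert ys ys-unique xs⊆ys ys⊆xs (no x∉ys) =
    x ∷ ys , ¬Any⇒All¬ ys x∉ys ∷ ys-unique ,
    (λ { (here refl) → here refl ; (there z∈xs) → there (xs⊆ys z∈xs) }) ,
    (λ { (here refl) → here refl ; (there z∈ys) → there (ys⊆xs z∈ys) })

concatAll : {P : A → Set ℓ} → (∀ {x} → P x → List B) → All P xs → List B
concatAll f []         = []
concatAll f (px ∷ pxs) = f px ++ concatAll f pxs

∈-concatAll : (f : ∀ {x} → P x → List B) (pxs : All P xs) (x∈xs : x ∈ xs) →
              f (All.lookup pxs x∈xs) ⊆ concatAll f pxs
∈-concatAll f (px ∷ _)   (here refl) = ∈-++⁺ˡ
∈-concatAll f (px ∷ pxs) (there x∈xs) = ∈-++⁺ʳ (f px) ∘ ∈-concatAll f pxs x∈xs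

concatAll⁺ : {R : B → Set ℓ′} (f : ∀ {x} → P x → List B) → (∀ {x} (px : P x) → All R (f px)) →
             (pxs : All P xs) → All R (concatAll f pxs)
concatAll⁺ f Rf []         = []
concatAll⁺ f Rf (px ∷ pxs) = ++⁺ (Rf px) (concatAll⁺ f Rf pxs)

length-concatAll : (f : ∀ {x} → P x → List B) (bound : A → ℕ) → (∀ {x} (px : P x) → length (f px) ≤ bound x) →
                   (pxs : All P xs) → length (concatAll f pxs) ≤ sum (map bound xs)
length-concatAll f bound f≤ []         = z≤n
length-concatAll f bound f≤ (px ∷ pxs) =
  ≤-trans (≤-reflexive (length-++ (f px))) (+-mono-≤ (f≤ px) (length-concatAll f bound f≤ pxs))

sum-map-const : ∀ (xs : List A) → sum (map (const n) xs) ≡ length xs * n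
sum-map-const []       = refl
sum-map-const (x ∷ xs) = cong (_ +_) (sum-map-const xs)

≤-sum-map : (f : A → ℕ) → x ∈ xs → f x ≤ sum (map f xs)
≤-sum-map f (here refl)  = m≤m+n _ _
≤-sum-map f (there x∈xs) = ≤-trans (≤-sum-map f x∈xs) (m≤n+m _ _)

allVecs : ∀ n → List (Vec Bool n)
allVecs zero    = [] ∷ []
allVecs (suc n) = map (true ∷_) (allVecs n) ++ map (false ∷_) (allVecs n)

∈-allVecs : (v : Vec Bool n) → v ∈ allVecs n
∈-allVecs []          = here refl
∈-allVecs (true ∷ v)  = ∈-++⁺ˡ (∈-map⁺ (true ∷_) (∈-allVecs v))
∈-allVecs (false ∷ v) = ∈-++⁺ʳ (map (true ∷_) (allVecs _)) (∈-map⁺ (false ∷_) (∈-allVecs v))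

image : {m : ℕ} → (Fin m → Fin n) → Vec Bool n
image h = Vec.tabulate λ j → isYes (any? λ i → h i ≟ᶠ j)

T-image : {m : ℕ} {h : Fin m → Fin n} (j : Fin n) → T (Vec.lookup (image h) j) ⇔ ∃ λ i → h i ≡ j
T-image {h = h} j rewrite lookup∘tabulate (λ j → isYes (any? λ i → h i ≟ᶠ j)) j = mk⇔ toWitness fromWitness

-- Families of distinct elements

-- AtLeast as a record: a Σ-type hides its predicate from unification, a record type does not.
record Family {A : Set a} (k : ℕ) (P : A → Set ℓ) : Set (a ⊔ ℓ) where
  constructor family
  field
    member    : Fin k → A
    injective : Injective _≡_ _≡_ member
    satisfies : ∀ i → P (member i)

  members : List A
  members = tabulate member

open Family using (member; members)

atLeast⇔family : AtLeast k P ⇔ Family k P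
atLeast⇔family = mk⇔ (λ (f , f-inj , Pf) → family f f-inj Pf) (λ (family f f-inj Pf) → f , f-inj , Pf)

family-members : (F : Family k P) → Family k (λ y → P y × y ∈ members F)
family-members (family f f-inj Pf) = family f f-inj λ m → Pf m , ∈-tabulate⁺ m

members-sound : (F : Family k P) → All P (members F)
members-sound (family _ _ Pf) = tabulate⁺ Pf

length-members : (F : Family k P) → length (members F) ≡ k
length-members (family f _ _) = length-tabulate f

unique⇒family : Unique xs → All P xs → Family (length xs) P
unique⇒family {xs = xs} xs-unique Pxs =
  family (lookup xs) (lookup-injective xs-unique) (All.lookup Pxs ∘ ∈-lookup)

family-image : {h : A → B} → Injective _≡_ _≡_ h → (∀ {x} → P x → Q (h x)) → Family k P → Family k Q
family-image {h = h} h-inj PQ (family f f-inj Pf) = family (h ∘ f) (f-inj ∘ h-inj) (PQ ∘ Pf)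

family-map : (∀ {x} → P x → Q x) → Family k P → Family k Q
family-map PQ (family f f-inj Pf) = family f f-inj (PQ ∘ Pf)

family-cong : (∀ x → P x ⇔ Q x) → Family k P ⇔ Family k Q
family-cong P⇔Q = mk⇔ (family-map λ {x} → to (P⇔Q x)) (family-map λ {x} → from (P⇔Q x))

family-≤ : k ≤ n → Family n P → Family k P
family-≤ k≤n (family f f-inj Pf) =
  family (f ∘ inject) (λ eq → inject≤-injective k≤n k≤n _ _ (f-inj eq)) (Pf ∘ inject)
  where
  inject : Fin _ → Fin _
  inject m = inject≤ m k≤n

family-preimage : {h : A → B} → Family k (λ y → P y × ∃ λ x → h x ≡ y) → Family k (P ∘ h)
family-preimage {P = P} {h = h} (family f f-inj Pf) =
  family pre pre-inj λ m → subst P (sym (h∘pre m)) (proj₁ (Pf m))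
  where
  pre : Fin _ → _
  pre m = proj₁ (proj₂ (Pf m))
  h∘pre : ∀ m → h (pre m) ≡ f m
  h∘pre m = proj₂ (proj₂ (Pf m))
  pre-inj : Injective _≡_ _≡_ pre
  pre-inj {m} {m′} eq = f-inj (trans (sym (h∘pre m)) (trans (cong h eq) (h∘pre m′)))

family-index : Family k (λ y → P y × y ∈ xs) → Family k (P ∘ lookup xs)
family-index {P = P} {xs = xs} F = family-preimage (family-map located F)
  where
  located : P y × y ∈ xs → P y × ∃ λ i → lookup xs i ≡ y
  located (Py , y∈xs) = Py , index y∈xs , sym (lookup-index y∈xs)

family-lookup : Unique xs → Family k (P ∘ lookup xs) → Family k P
family-lookup xs-unique = family-image (lookup-injective xs-unique) id

maximal-family-complete : ¬ Family (suc k) P → (F : Family k P) → P y → ¬ ¬ y ∈ members F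
maximal-family-complete {P = P} {y = y} maximal (family f f-inj Pf) Py y∉F =
  maximal (family (y ∷ᶠ f) y∷f-inj Py∷f)
  where
  y∷f-inj : Injective _≡_ _≡_ (y ∷ᶠ f)
  y∷f-inj = cons-injective f-inj λ m y≡fm → y∉F (subst (_∈ tabulate f) (sym y≡fm) (∈-tabulate⁺ m))
  Py∷f : ∀ m → P ((y ∷ᶠ f) m)
  Py∷f zero    = Py
  Py∷f (suc m) = Pf m

record Saturated {A : Set a} (K : ℕ) (P : A → Set ℓ) : Set (a ⊔ ℓ) where
  constructor saturatedFamily
  field
    size    : ℕ
    size≤K  : size ≤ K
    chosen  : Family size P
    maximal : size ≡ K ⊎ ¬ Family (suc size) P

open Saturated using (size≤K; chosen)

length-chosen : ∀ {K} (F : Saturated K P) → length (members (chosen F)) ≤ K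
length-chosen F = ≤-trans (≤-reflexive (length-members (chosen F))) (size≤K F)

saturated : ∀ K (P : A → Set ℓ) → ¬ ¬ Saturated K P
saturated zero    P = return (saturatedFamily 0 z≤n (family (λ ()) (λ { {()} }) (λ ())) (inj₁ refl))
saturated (suc K) P = saturated K P >>= grow
  where
  grow : Saturated K P → ¬ ¬ Saturated (suc K) P
  grow (saturatedFamily k k≤K F (inj₂ maximal)) = return (saturatedFamily k (m≤n⇒m≤1+n k≤K) F (inj₂ maximal))
  grow (saturatedFamily k k≤K F (inj₁ refl))    = ¬¬-map extend ¬¬-excluded-middle
    where
    extend : Dec (Family (suc k) P) → Saturated (suc K) P
    extend (yes F′)  = saturatedFamily (suc k) ≤-refl F′ (inj₁ refl)
    extend (no ¬F′) = saturatedFamily k (n≤1+n k) F (inj₂ ¬F′)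

saturated-covers : ∀ {K} (F : Saturated K P) → P y →
                   ¬ ¬ (y ∈ members (chosen F) ⊎ Family K (λ z → P z × z ∈ members (chosen F)))
saturated-covers (saturatedFamily _ _ F (inj₁ refl))    _  = return (inj₂ (family-members F))
saturated-covers (saturatedFamily _ _ F (inj₂ maximal)) Py = ¬¬-map inj₁ (maximal-family-complete maximal F Py)

saturated-≥ : ∀ {K} (F : Saturated K P) → k ≤ K → Family k P → Family k (λ z → P z × z ∈ members (chosen F))
saturated-≥ {P = P} {k = k} {K = K} (saturatedFamily size _ F maximal) k≤K Pk =
  family-≤ (k≤size maximal) (family-members F)
  where
  k≤size : size ≡ K ⊎ ¬ Family (suc size) P → k ≤ size
  k≤size (inj₁ refl)    = k≤K
  k≤size (inj₂ maximal) = ≮⇒≥ λ size<k → maximal (family-≤ size<k Pk)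

module Embedding {_~_ : A → A → Set ℓ} (~-refl : ∀ {x} → x ~ x) {S : List A} (S-unique : Unique S) {Th : ℕ}
                 (rich : ∀ w → ¬ ¬ (w ∈ S ⊎ Family Th (λ i → lookup S i ~ w))) where

  private
    e : Fin (length S) → A
    e = lookup S

  -- An image is the element itself or lies outside W, so elements of W met later can still be fixed.
  Embeds : (W V : List A) → (Fin (length V) → Fin (length S)) → Set _
  Embeds W V h = Injective _≡_ _≡_ h × (∀ i → e (h i) ~ lookup V i) × (∀ i → e (h i) ≡ lookup V i ⊎ e (h i) ∉ W)

  Target : (W V : List A) → (Fin (length V) → Fin (length S)) → A → Set _
  Target W V h v = Σ (Fin (length S)) λ j → e j ~ v × (e j ≡ v ⊎ e j ∉ W) × (∀ i → j ≢ h i)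

  target : ∀ {v} W V (h : Fin (length V) → Fin (length S)) → (∀ i → e (h i) ≡ lookup V i ⊎ e (h i) ∉ W) →
           v ∈ W → All (v ≢_) V → length W + length V < Th → ¬ ¬ Target W V h v
  target {v} W V h h-fix v∈W v∉V |W|+|V|<Th = rich v >>= choose
    where
    fixed-distinct : ∀ i → v ≢ e (h i)
    fixed-distinct i v≡ehi with h-fix i
    ... | inj₁ ehi≡Vi = All.lookup v∉V (∈-lookup i) (trans v≡ehi ehi≡Vi)
    ... | inj₂ ehi∉W  = ehi∉W (subst (_∈ W) v≡ehi v∈W)

    |W++h|<Th : length (W ++ tabulate (e ∘ h)) < Th
    |W++h|<Th = subst (_< Th) (sym (trans (length-++ W) (cong (length W +_) (length-tabulate _)))) |W|+|V|<Th

    choose : v ∈ S ⊎ Family Th (λ i → e i ~ v) → ¬ ¬ Target W V h v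
    choose (inj₁ v∈S) = return
      ( index v∈S , subst (_~ v) (lookup-index v∈S) ~-refl , inj₁ (sym (lookup-index v∈S))
      , λ i j≡hi → fixed-distinct i (trans (lookup-index v∈S) (cong e j≡hi)))
    choose (inj₂ (family g g-inj g~v)) = do
      (m , gm∉) ← injective⇒¬¬∃∉ {xs = W ++ tabulate (e ∘ h)} (g-inj ∘ lookup-injective S-unique) |W++h|<Th
      return (g m , g~v m , inj₂ (gm∉ ∘ ∈-++⁺ˡ) ,
              λ i gm≡hi → gm∉ (∈-++⁺ʳ W (subst (_∈ tabulate (e ∘ h)) (cong e (sym gm≡hi)) (∈-tabulate⁺ i))))

  embeds : ∀ W V → Unique V → V ⊆ W → length W + length V ≤ Th → ¬ ¬ ∃ (Embeds W V)
  embeds W []      _                  _    _     = return ((λ ()) , (λ { {()} }) , (λ ()) , (λ ()))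
  embeds W (v ∷ V) (v∉V ∷ V-unique) v∷V⊆W bound = do
    (h , h-inj , h~ , h-fix) ←
      embeds W V V-unique (v∷V⊆W ∘ there) (≤-trans (+-mono-≤ (≤-refl {length W}) (n≤1+n _)) bound)
    (j , j~v , j-fix , j-new) ←
      target W V h h-fix (v∷V⊆W (here refl)) v∉V (subst (_≤ Th) (+-suc (length W) (length V)) bound)
    return ( j ∷ᶠ h , (λ {i} {i′} → cons-injective h-inj j-new {i} {i′})
           , (λ { zero → j~v ; (suc i) → h~ i }) , (λ { zero → j-fix ; (suc i) → h-fix i }))

  embed : (W : List A) → Unique W → length W + length W ≤ Th →
          ¬ ¬ Σ (Fin (length W) → Fin (length S)) λ h → Injective _≡_ _≡_ h × ∀ i → e (h i) ~ lookup W i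
  embed W W-unique bound =
    ¬¬-map (λ (h , h-inj , h~ , _) → h , (λ {i j} → h-inj) , h~) (embeds W W W-unique id bound)

-- Small models are decidable

Table : (NU NB n : ℕ) → Set
Table NU NB n = Vec (Vec Bool n) NU × Vec (Vec (Vec Bool n) n) NB

-- Predicates outside the table are interpreted as empty.
⟦_⟧ : ∀ {NU NB} → Table NU NB n → Interp (Fin n) 0ℓ
⟦_⟧ {n = n} (u , b) = record
  { unary  = λ p i → T (Vec.lookup (lookupOr (Vec.replicate n false) u p) i)
  ; binary = λ r i j → T (Vec.lookup (Vec.lookup (lookupOr (Vec.replicate n (Vec.replicate n false)) b r) i) j)
  }

family? : {P : Fin n → Set ℓ} → Decidable P → ∀ k → Dec (Family k P)
family? {n = n} P? k with k ≤? length (filter P? (allFin n))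
... | yes k≤ = yes (family-≤ k≤ (unique⇒family (filter⁺ P? (allFin⁺ n)) (all-filter P? (allFin n))))
... | no  k≰ = no λ (family f f-inj Pf) →
  k≰ (injective⇒≤length f-inj λ m → ∈-filter⁺ P? (∈-allFin (f m)) (Pf m))

count? : {P : Fin n → Set ℓ} → Decidable P → ∀ c C → Dec (Count c C P)
count? P? le C = ¬? (map′ (from atLeast⇔family) (to atLeast⇔family) (family? P? (suc C)))
count? P? ge C = map′ (from atLeast⇔family) (to atLeast⇔family) (family? P? C)

⊨? : ∀ {NU NB} (τ : Table NU NB n) (φ : N2) → Dec (⟦ τ ⟧ ⊨ φ)
⊨? τ (pos c C p q)         = count? (λ _ → T? _ ×-dec T? _) c C
⊨? τ (neg c C p q)         = count? (λ _ → T? _ ×-dec ¬? (T? _)) c C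
⊨? τ (nest c C p c′ D q r) = count? (λ _ → T? _ ×-dec count? (λ _ → T? _ ×-dec T? _) c′ D) c C

Searchable : Set → Set₁
Searchable A = ∀ {P : A → Set} → Decidable P → Dec (∃ P)

search-Bool : Searchable Bool
search-Bool P? = map′ (λ { (inj₁ p) → true , p ; (inj₂ p) → false , p })
                      (λ { (true , p) → inj₁ p ; (false , p) → inj₂ p })
                      (P? true ⊎-dec P? false)

search-× : {A B : Set} → Searchable A → Searchable B → Searchable (A × B)
search-× search-A search-B P? =
  map′ (λ (x , y , p) → (x , y) , p) (λ ((x , y) , p) → x , y , p) (search-A λ x → search-B λ y → P? (x , y))

search-Vec : {A : Set} → Searchable A → ∀ n → Searchable (Vec A n)
search-Vec search-A zero    P? = map′ ([] ,_) (λ { ([] , p) → p }) (P? [])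
search-Vec search-A (suc n) P? = map′ (λ (x , v , p) → x ∷ v , p) (λ { (x ∷ v , p) → x , v , p })
                                      (search-A λ x → search-Vec search-A n λ v → P? (x ∷ v))

search-Table : ∀ NU NB n → Searchable (Table NU NB n)
search-Table NU NB n = search-× (search-Vec (search-Vec search-Bool n) NU)
                                (search-Vec (search-Vec (search-Vec search-Bool n) n) NB)

SmallModel : (bound NU NB : ℕ) → List N2 → Set
SmallModel bound NU NB Φ = ∃ λ n → n < bound × Σ (Table NU NB (suc n)) λ τ → ⟦ τ ⟧ ⊨all Φ

smallModel? : ∀ bound NU NB Φ → Dec (SmallModel bound NU NB Φ)
smallModel? bound NU NB Φ = anyUpTo? (λ n → search-Table NU NB (suc n) λ τ → All.all? (⊨? τ) Φ) bound

-- A small model inside an arbitrary one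

module Types {D : Set a} (M : Interp D ℓ) (NU : ℕ) where

  SameType : D → D → Set ℓ
  SameType x y = ∀ {p} → p < NU → unary M p x ⇔ unary M p y

  HasType : Vec Bool NU → D → Set ℓ
  HasType t y = ∀ {p} → p < NU → T (lookupOr false t p) ⇔ unary M p y

  typeOf : ∀ y → ¬ ¬ ∃ λ t → HasType t y
  typeOf y = ¬¬-vec false λ {p} _ → ¬¬-truth-value (unary M p y)

  hasType⇒sameType : ∀ {t x y} → HasType t x → HasType t y → SameType x y
  hasType⇒sameType x∶t y∶t p<NU = y∶t p<NU ⇔-∘ ⇔-sym (x∶t p<NU)

  Rich : List D → ℕ → Set (a ⊔ ℓ)
  Rich S Th = ∀ w → ¬ ¬ (w ∈ S ⊎ Family Th (λ i → SameType (lookup S i) w))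

module Rows {D : Set a} (M : Interp D ℓ) (NU K : ℕ) {S : List D} (S-unique : Unique S)
            (rich : Types.Rich M NU S (NU * K + NU * K)) where

  open Types M NU
  open Embedding {_~_ = SameType} (λ {x} {p} _ → ⇔-id (unary M p x)) S-unique rich using (embed)

  RowSpec : ℕ → D → Vec Bool (length S) → Set (a ⊔ ℓ)
  RowSpec r x row = ∀ {q} → q < NU → ∀ {k} → k ≤ K →
    Family k (λ j → unary M q (lookup S j) × T (Vec.lookup row j)) ⇔
    Family k (λ y → unary M q y × binary M r x y)

  module _ (r : ℕ) (x : D) where

    Successor : ℕ → D → Set ℓ
    Successor q y = unary M q y × binary M r x y

    candidates : All (λ q → Saturated K (Successor q)) (upTo NU) → List D
    candidates = concatAll (λ F → members (chosen F))

    candidate-successor : (Fs : All (λ q → Saturated K (Successor q)) (upTo NU)) →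
                          All (binary M r x) (candidates Fs)
    candidate-successor = concatAll⁺ _ (λ F → All.map proj₂ (members-sound (chosen F)))

    length-candidates : (Fs : All (λ q → Saturated K (Successor q)) (upTo NU)) → length (candidates Fs) ≤ NU * K
    length-candidates Fs = ≤-trans
      (length-concatAll _ (const K) length-chosen Fs)
      (≤-reflexive (trans (sum-map-const (upTo NU)) (cong (_* K) (length-upTo NU))))

    module _ (Fs : All (λ q → Saturated K (Successor q)) (upTo NU))
             {W : List D} (W-unique : Unique W) (C⊆W : candidates Fs ⊆ W) (W⊆C : W ⊆ candidates Fs)
             {h : Fin (length W) → Fin (length S)} (h-inj : Injective _≡_ _≡_ h)
             (h-type : ∀ i → SameType (lookup S (h i)) (lookup W i)) where

      image-sound : ∀ {q} → q < NU → Family k (λ j → unary M q (lookup S j) × T (Vec.lookup (image h) j)) →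
                    Family k (Successor q)
      image-sound q<NU F = family-lookup W-unique (family-map
        (λ {i} Uq → to (h-type i q<NU) Uq , All.lookup (candidate-successor Fs) (W⊆C (∈-lookup i)))
        (family-preimage (family-map (λ (Uq , Tj) → Uq , to (T-image _) Tj) F)))

      image-complete : ∀ {q} → q < NU → k ≤ K → Family k (Successor q) →
                       Family k (λ j → unary M q (lookup S j) × T (Vec.lookup (image h) j))
      image-complete q<NU k≤K F = family-image h-inj
        (λ {i} Uq → from (h-type i q<NU) Uq , from (T-image (h i)) (i , refl))
        (family-index (family-map
          (λ ((Uq , _) , y∈F) → Uq , C⊆W (∈-concatAll _ Fs (∈-upTo⁺ q<NU) y∈F))
          (saturated-≥ (All.lookup Fs (∈-upTo⁺ q<NU)) k≤K F)))

    row : ¬ ¬ Σ (Vec Bool (length S)) (RowSpec r x)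
    row = do
      Fs ← ¬¬-All (λ q → saturated K (Successor q)) (upTo NU)
      (W , W-unique , C⊆W , W⊆C) ← deduplicate (candidates Fs)
      let |W|≤NU*K = ≤-trans (unique⊆⇒length≤ W-unique W⊆C) (length-candidates Fs)
      (h , h-inj , h-type) ← embed W W-unique (+-mono-≤ |W|≤NU*K |W|≤NU*K)
      return (image h , λ {q} q<NU {k} k≤K →
        mk⇔ (image-sound Fs W-unique C⊆W W⊆C h-inj h-type q<NU)
            (image-complete Fs W-unique C⊆W W⊆C h-inj h-type q<NU k≤K))

countWitnesses : (c : Cmp) (P : A → Set ℓ) → Count c C P → List A
countWitnesses le _ _       = []
countWitnesses ge _ (f , _) = tabulate f

length-countWitnesses : (c : Cmp) (P : A → Set ℓ) (cnt : Count c C P) → length (countWitnesses c P cnt) ≤ C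
length-countWitnesses le _ _       = z≤n
length-countWitnesses ge _ (f , _) = ≤-reflexive (length-tabulate f)

count-cong : (c : Cmp) → (∀ {k} → k ≤ suc C → Family k P ⇔ Family k Q) → Count c C P ⇔ Count c C Q
count-cong le agree = ¬-cong-⇔ (⇔-sym atLeast⇔family ⇔-∘ (agree ≤-refl ⇔-∘ atLeast⇔family))
count-cong ge agree = ⇔-sym atLeast⇔family ⇔-∘ (agree (n≤1+n _) ⇔-∘ atLeast⇔family)

outerCount : N2 → ℕ
outerCount (pos _ C _ _)         = C
outerCount (neg _ C _ _)         = C
outerCount (nest _ C _ _ _ _ _) = C

module _ {D : Set a} (M : Interp D ℓ) where

  witnesses : (φ : N2) → M ⊨ φ → List D
  witnesses (pos c _ _ _)         = countWitnesses c _
  witnesses (neg c _ _ _)         = countWitnesses c _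
  witnesses (nest c _ _ _ _ _ _) = countWitnesses c _

  length-witnesses : (φ : N2) (s : M ⊨ φ) → length (witnesses φ s) ≤ outerCount φ
  length-witnesses (pos c _ _ _)         = length-countWitnesses c _
  length-witnesses (neg c _ _ _)         = length-countWitnesses c _
  length-witnesses (nest c _ _ _ _ _ _) = length-countWitnesses c _

  allWitnesses : {Φ : List N2} → M ⊨all Φ → List D
  allWitnesses = concatAll (λ {φ} → witnesses φ)

data Within (NU NB K : ℕ) : N2 → Set where
  pos  : ∀ {c C p q} → p < NU → q < NU → Within NU NB K (pos c C p q)
  neg  : ∀ {c C p q} → p < NU → q < NU → Within NU NB K (neg c C p q)
  nest : ∀ {c C p c′ D q r} → p < NU → q < NU → r < NB → D < K → Within NU NB K (nest c C p c′ D q r)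

unaryBound : N2 → ℕ
unaryBound (pos _ _ p q)         = suc (p + q)
unaryBound (neg _ _ p q)         = suc (p + q)
unaryBound (nest _ _ p _ _ q _) = suc (p + q)

binaryBound : N2 → ℕ
binaryBound (nest _ _ _ _ _ _ r) = suc r
binaryBound _                     = 0

innerBound : N2 → ℕ
innerBound (nest _ _ _ _ D _ _) = suc D
innerBound _                     = 0

within : ∀ {NU NB K} φ → unaryBound φ ≤ NU → binaryBound φ ≤ NB → innerBound φ ≤ K → Within NU NB K φ
within (pos _ _ p q)         u≤ _   _   = pos (≤-trans (s≤s (m≤m+n p q)) u≤) (≤-trans (s≤s (m≤n+m q p)) u≤)
within (neg _ _ p q)         u≤ _   _   = neg (≤-trans (s≤s (m≤m+n p q)) u≤) (≤-trans (s≤s (m≤n+m q p)) u≤)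
within (nest _ _ p _ _ q r) u≤ b≤ i≤ = nest (≤-trans (s≤s (m≤m+n p q)) u≤) (≤-trans (s≤s (m≤n+m q p)) u≤) b≤ i≤

module Preservation {D : Set a} {M : Interp D ℓ} {S : List D} (S-unique : Unique S)
                    {N : Interp (Fin (length S)) ℓ′} {NU NB K : ℕ}
                    (unary-agrees : ∀ {p} → p < NU → ∀ i → unary N p i ⇔ unary M p (lookup S i))
                    (rows-agree : ∀ {r} → r < NB → ∀ i {q} → q < NU → ∀ {k} → k ≤ K →
                                  Family k (λ j → unary M q (lookup S j) × binary N r i j) ⇔
                                  Family k (λ y → unary M q y × binary M r (lookup S i) y)) where

  count-restrict : ∀ {ℓ₁ ℓ₂} (c : Cmp) {P : D → Set ℓ₁} {Q : Fin (length S) → Set ℓ₂} →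
                   (∀ i → Q i ⇔ P (lookup S i)) → (cnt : Count c C P) → countWitnesses c P cnt ⊆ S → Count c C Q
  count-restrict le {P = P} Q⇔P ¬P≥ _ Q≥ =
    ¬P≥ (from (atLeast⇔family {P = P})
          (family-image (lookup-injective S-unique) (λ {i} → to (Q⇔P i)) (to atLeast⇔family Q≥)))
  count-restrict ge {P = P} Q⇔P F F⊆S = from atLeast⇔family (family-map (λ {i} → from (Q⇔P i))
    (family-index (family-map (λ (Py , y∈F) → Py , F⊆S y∈F) (family-members (to (atLeast⇔family {P = P}) F)))))

  preserves : ∀ {φ} → Within NU NB K φ → (s : M ⊨ φ) → witnesses M φ s ⊆ S → N ⊨ φ
  preserves (pos {c} p<NU q<NU) = count-restrict c λ i → unary-agrees p<NU i ×-⇔ unary-agrees q<NU i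
  preserves (neg {c} p<NU q<NU) = count-restrict c λ i → unary-agrees p<NU i ×-⇔ ¬-cong-⇔ (unary-agrees q<NU i)
  preserves (nest {c} {c′ = c′} p<NU q<NU r<NB D<K) = count-restrict c λ i →
    unary-agrees p<NU i ×-⇔ count-cong c′ λ k≤1+D →
      rows-agree r<NB i q<NU (≤-trans k≤1+D D<K) ⇔-∘ family-cong (λ j → unary-agrees q<NU j ×-⇔ ⇔-id _)

  preservesAll : ∀ {Φ} → All (Within NU NB K) Φ → (ss : M ⊨all Φ) → allWitnesses M ss ⊆ S → N ⊨all Φ
  preservesAll []       []       _   = []
  preservesAll (w ∷ ws) (s ∷ ss) ⊆S = preserves w s (⊆S ∘ ∈-++⁺ˡ) ∷ preservesAll ws ss (⊆S ∘ ∈-++⁺ʳ _)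

module FiniteModel {D : Set a} {M : Interp D ℓ} (d : D) {Φ : List N2} (M⊨Φ : M ⊨all Φ) where

  -- A row uses at most NU * K successors, and embedding them needs twice as many representatives per type.
  NU NB K Th bound : ℕ
  NU    = sum (map unaryBound Φ)
  NB    = sum (map binaryBound Φ)
  K     = sum (map innerBound Φ)
  Th    = NU * K + NU * K
  bound = suc (sum (map outerCount Φ) + length (allVecs NU) * Th)

  open Types M NU

  within-all : All (Within NU NB K) Φ
  within-all = All.tabulate λ {φ} φ∈Φ →
    within φ (≤-sum-map unaryBound φ∈Φ) (≤-sum-map binaryBound φ∈Φ) (≤-sum-map innerBound φ∈Φ)

  Representatives : Set _
  Representatives = All (λ t → Saturated Th (HasType t)) (allVecs NU)

  representatives : Representatives → List D
  representatives = concatAll (λ F → members (chosen F))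

  rich : (Fs : Representatives) {S : List D} → representatives Fs ⊆ S → Rich S Th
  rich Fs {S} reps⊆S w = typeOf w >>= λ (t , w∶t) → ¬¬-map (represent w∶t) (saturated-covers (familyOf t) w∶t)
    where
    familyOf : ∀ t → Saturated Th (HasType t)
    familyOf t = All.lookup Fs (∈-allVecs t)
    represent : ∀ {t} → HasType t w →
                w ∈ members (chosen (familyOf t)) ⊎
                Family Th (λ z → HasType t z × z ∈ members (chosen (familyOf t))) →
                w ∈ S ⊎ Family Th (λ i → SameType (lookup S i) w)
    represent _   (inj₁ w∈F) = inj₁ (reps⊆S (∈-concatAll _ Fs (∈-allVecs _) w∈F))
    represent {t} w∶t (inj₂ F) = inj₂ (family-index (family-map
      (λ (z∶t , z∈F) → (λ {p} → hasType⇒sameType {t} z∶t w∶t {p}) ,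
                       reps⊆S (∈-concatAll _ Fs (∈-allVecs _) z∈F)) F))

  length-domain : (Fs : Representatives) → length (allWitnesses M M⊨Φ ++ representatives Fs) < bound
  length-domain Fs = s≤s (≤-trans (≤-reflexive (length-++ (allWitnesses M M⊨Φ))) (+-mono-≤
    (length-concatAll _ outerCount (λ {φ} → length-witnesses M φ) M⊨Φ)
    (≤-trans (length-concatAll _ (const Th) length-chosen Fs) (≤-reflexive (sum-map-const (allVecs NU))))))

  domain : ¬ ¬ Σ (List D) λ S → Unique S × Rich S Th × d ∈ S × allWitnesses M M⊨Φ ⊆ S × length S ≤ bound
  domain = do
    Fs ← ¬¬-All (λ t → saturated Th (HasType t)) (allVecs NU)
    (S , S-unique , S₀⊆S , S⊆S₀) ← deduplicate (d ∷ allWitnesses M M⊨Φ ++ representatives Fs)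
    return (S , S-unique , rich Fs (λ z∈ → S₀⊆S (there (∈-++⁺ʳ _ z∈))) , S₀⊆S (here refl) ,
            (λ {z} z∈ → S₀⊆S (there (∈-++⁺ˡ z∈))) , ≤-trans (unique⊆⇒length≤ S-unique S⊆S₀) (length-domain Fs))

  tables : (S : List D) → Unique S → Rich S Th → allWitnesses M M⊨Φ ⊆ S →
           ¬ ¬ Σ (Table NU NB (length S)) λ τ → ⟦ τ ⟧ ⊨all Φ
  tables S S-unique rich ws⊆S = do
    (u , u-spec) ← ¬¬-vec (Vec.replicate _ false) λ {p} _ →
      ¬¬-tabulate λ i → ¬¬-truth-value (unary M p (lookup S i))
    (b , b-spec) ← ¬¬-vec (Vec.replicate _ (Vec.replicate _ false)) λ {r} _ →
      ¬¬-tabulate λ i → row r (lookup S i)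
    return ((u , b) , Preservation.preservesAll S-unique u-spec b-spec within-all M⊨Φ ws⊆S)
    where open Rows M NU K S-unique rich using (row)

  smallModel : ¬ ¬ SmallModel bound NU NB Φ
  smallModel = do
    (S , S-unique , rich , d∈S , ws⊆S , |S|≤bound) ← domain
    (τ , ⟦τ⟧⊨Φ) ← tables S S-unique rich ws⊆S
    return (small S d∈S |S|≤bound τ ⟦τ⟧⊨Φ)
    where
    small : (S : List D) → d ∈ S → length S ≤ bound → (τ : Table NU NB (length S)) → ⟦ τ ⟧ ⊨all Φ →
            SmallModel bound NU NB Φ
    small (_ ∷ S′) _ |S|≤bound τ ⟦τ⟧⊨Φ = length S′ , |S|≤bound , τ , ⟦τ⟧⊨Φ

lemma9 : {a ℓ : Level} (Φ : List N2) → HasModel a ℓ Φ → HasFiniteModel Φ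
lemma9 Φ (D , d , M , M⊨Φ) =
  let open FiniteModel d M⊨Φ
      (n , _ , τ , ⟦τ⟧⊨Φ) = decidable-stable (smallModel? bound NU NB Φ) smallModel
  in n , ⟦ τ ⟧ , ⟦τ⟧⊨Φ
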